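{- Let $m,n\ge 0$ be integers, let $H$ be a word with $m$ letters $\rightarrow$ and $m$ letters $\leftarrow$, and let $V$ be a word with $n$ letters $\uparrow$ and $n$ letters $\downarrow$. Then for every integer $k\ge 0$, the number of shuffles of $V$ and $H$ whose signed peak-count has absolute value $k$ equals the number of words in $W^m_n$ with absolute even-count $k$. Consequently, $F(m,m,n,n)=\sum_{w\in W^m_n} x^{\text{absolute even-count of } w}$.
   Context: A shuffle of $V$ and $H$ is a word obtained by interleaving the letters of $V$ and $H$, preserving the order within $V$ and within $H$ (distinct interleavings counted separately). The signed peak-count of a shuffle is the number of occurrences of $\uparrow$ immediately followed by $\leftarrow$ minus the number of occurrences of $\rightarrow$ immediately followed by $\downarrow$. For nonnegative integers $r,l,u,d$, $F(r,l,u,d)\in\mathbb{Z}[x]$ is the polynomial $\sum_\sigma x^{|\text{signed peak-count of }\sigma|}$, summed over all shuffles $\sigma$ of a word with $u$ letters $\uparrow$ and $d$ letters $\downarrow$ with a word with $r$ letters $\rightarrow$ and $l$ letters $\leftarrow$ (this polynomial does not depend on the order of the letters in these words). $W^m_n$ is the set of binary words with $2m$ zeroes and $2n$ ones, with positions indexed $1,2,\dots,2m+2n$. The shifted even-count of a binary word is (number of ones in even-indexed positions) $-\frac12$(number of ones), and the absolute even-count is its absolute value. -}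

module Defs where

open import Data.Nat using (ℕ; zero; suc; _+_; _*_; _/_)
open import Data.Integer using (ℤ; +_; _-_; ∣_∣)
open import Data.Bool using (Bool; true; false; if_then_else_)
open import Data.List using (List; []; _∷_; _++_; map; length; filter; replicate; concatMap)
open import Relation.Nullary using (Dec; yes; no)
open import Relation.Binary.PropositionalEquality using (_≡_; refl)

data Arrow : Set where
  right left up down : Arrow

occ : Arrow → List Arrow → ℕ
occ a [] = 0
occ right (right ∷ w) = suc (occ right w)
occ left  (left  ∷ w) = suc (occ left w)
occ up    (up    ∷ w) = suc (occ up w)
occ down  (down  ∷ w) = suc (occ down w)
occ a (_ ∷ w) = occ a w

data Horizontal : Arrow → Set where
  h-right : Horizontal right
  h-left  : Horizontal left

data Vertical : Arrow → Set where
  v-up   : Vertical up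
  v-down : Vertical down

-- all shuffles (interleavings) of two words, as a list with multiplicity:
-- one entry per interleaving
shuffles : {A : Set} → List A → List A → List (List A)
shuffles [] ys = ys ∷ []
shuffles (x ∷ xs) [] = (x ∷ xs) ∷ []
shuffles (x ∷ xs) (y ∷ ys) =
  map (x ∷_) (shuffles xs (y ∷ ys)) ++ map (y ∷_) (shuffles (x ∷ xs) ys)

upLeft : List Arrow → ℕ
upLeft (up ∷ left ∷ w) = suc (upLeft (left ∷ w))
upLeft (_ ∷ w) = upLeft w
upLeft [] = 0

rightDown : List Arrow → ℕ
rightDown (right ∷ down ∷ w) = suc (rightDown (down ∷ w))
rightDown (_ ∷ w) = rightDown w
rightDown [] = 0

signedPeak : List Arrow → ℤ
signedPeak w = + upLeft w - + rightDown w

absPeak : List Arrow → ℕ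
absPeak w = ∣ signedPeak w ∣

countAbsPeak : ℕ → List (List Arrow) → ℕ
countAbsPeak k ws = length (filter (λ σ → absPeak σ Data.Nat.≟ k) ws)

-- coefficient of x^k in F(r,l,u,d), computed with the words
-- V = ↑^u ↓^d and H = →^r ←^l (F does not depend on the order of letters)
F-coeff : ℕ → ℕ → ℕ → ℕ → ℕ → ℕ
F-coeff r l u d k =
  countAbsPeak k (shuffles (replicate u up ++ replicate d down)
                           (replicate r right ++ replicate l left))

-- binary words: true = 1, false = 0
allWords : ℕ → List (List Bool)
allWords zero = [] ∷ []
allWords (suc n) = map (false ∷_) (allWords n) ++ map (true ∷_) (allWords n)

ones : List Bool → ℕ
ones [] = 0
ones (true ∷ w) = suc (ones w)
ones (false ∷ w) = ones w

W : ℕ → ℕ → List (List Bool)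
W m n = filter (λ w → ones w Data.Nat.≟ 2 * n) (allWords (2 * m + 2 * n))

-- ones at odd / even positions (positions indexed from 1)
mutual
  onesOdd : List Bool → ℕ
  onesOdd [] = 0
  onesOdd (b ∷ w) = (if b then 1 else 0) + onesEven w

  onesEven : List Bool → ℕ
  onesEven [] = 0
  onesEven (b ∷ w) = onesOdd w

-- absolute even-count |#ones at even positions - (1/2) #ones|.
-- Here twice the shifted even-count is an integer; we take |2·e - ones| / 2,
-- which equals the absolute even-count whenever #ones is even (as in W^m_n).
absEvenCount : List Bool → ℕ
absEvenCount w = ∣ + (2 * onesEven w) - + ones w ∣ / 2

countAbsEven : ℕ → List (List Bool) → ℕ
countAbsEven k ws = length (filter (λ w → absEvenCount w Data.Nat.≟ k) ws)

module Submission where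

-- Both statistics already agree in their SIGNED forms, with the explicit
-- distribution  Φ a b μ ν s = C(a, μ − s) · C(b, ν + s).
--
-- Shuffles: for vertical V (u ↑'s, d ↓'s) and horizontal H (r →'s, l ←'s),
-- the shuffles with signed peak-count s number Φ (u + r) (l + d) u d s.  As a
-- peak involves two adjacent letters, the induction along the shuffle
-- recursion remembers the previously emitted letter p ('peaksAfter'); its
-- closed form 'peakLaw' is a Φ, shifted when p may start a peak, and every
-- step is Pascal's rule in one of the two binomial factors.
-- Binary words: those of length 2(m + n) with α ones at odd and β at even
-- positions number C(m + n, α) · C(m + n, β), so the words of W^m_n whose
-- even-count exceeds n by s number Φ (m + n) (m + n) n n s.
-- Equal signed distributions give equal absolute ones; F(m,m,n,n) is the
-- case V = ↑ⁿ↓ⁿ, H = →ᵐ←ᵐ.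

open import Defs
open import Data.Nat using (ℕ)
open import Data.List using (List)
open import Data.List.Relation.Unary.All using (All)
open import Data.Product using (_×_)
open import Relation.Binary.PropositionalEquality using (_≡_)

open import Data.Nat as ℕ using (zero; suc; _+_; _*_; _/_; ⌊_/2⌋; ⌈_/2⌉)
import Data.Nat.Properties as ℕₚ
open import Data.Nat.DivMod using (m*n/n≡m)
open import Data.Nat.Combinatorics using (_C_; nCn≡1; k>n⇒nCk≡0; nCk+nC[k+1]≡[n+1]C[k+1])
import Data.Nat.Tactic.RingSolver as ℕ-Solver
open import Data.Integer as ℤ using (ℤ; +_; -[1+_]; 0ℤ; 1ℤ; -1ℤ; _-_; ∣_∣)
import Data.Integer.Properties as ℤₚ
open import Data.Integer.Tactic.RingSolver using (solve-∀)
open import Data.Bool using (Bool; true; false; if_then_else_)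
open import Data.Empty using (⊥-elim)
open import Data.Sum using (_⊎_; inj₁; inj₂)
open import Data.Product using (_,_; swap)
open import Data.List using ([]; _∷_; _++_; map; filter; length; replicate)
open import Data.List.Properties using (filter-++; filter-≐; length-++)
open import Data.List.Relation.Unary.All using ([]; _∷_)
open import Data.List.Relation.Unary.All.Properties using (++⁺; replicate⁺)
open import Relation.Nullary using (¬_; does; yes; no)
open import Relation.Unary using (Decidable; _≐_)
open import Relation.Unary.Properties using (_∩?_; _∪?_; ≐-refl)
open import Relation.Binary.PropositionalEquality using (refl; sym; trans; cong; cong₂; module ≡-Reasoning)
open ≡-Reasoning

private
  variable
    X Y : Set

count : {P : X → Set} → Decidable P → List X → ℕ
count P? xs = length (filter P? xs)

count-++ : {P : X → Set} (P? : Decidable P) (xs ys : List X) →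
           count P? (xs ++ ys) ≡ count P? xs + count P? ys
count-++ P? xs ys = trans (cong length (filter-++ P? xs ys)) (length-++ (filter P? xs))

count-map : {P : Y → Set} (P? : Decidable P) (f : X → Y) (xs : List X) →
            count P? (map f xs) ≡ count (λ x → P? (f x)) xs
count-map P? f [] = refl
count-map P? f (x ∷ xs) with does (P? (f x))
... | true  = cong suc (count-map P? f xs)
... | false = count-map P? f xs

count-≐ : {P Q : X → Set} (P? : Decidable P) (Q? : Decidable Q) →
          P ≐ Q → (xs : List X) → count P? xs ≡ count Q? xs
count-≐ P? Q? P≐Q xs = cong length (filter-≐ P? Q? P≐Q xs)

count-filter : {P Q : X → Set} (P? : Decidable P) (Q? : Decidable Q) (xs : List X) →
               count P? (filter Q? xs) ≡ count (Q? ∩? P?) xs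
count-filter P? Q? [] = refl
count-filter P? Q? (x ∷ xs) with does (Q? x)
... | false = count-filter P? Q? xs
... | true with does (P? x)
...   | true  = cong suc (count-filter P? Q? xs)
...   | false = count-filter P? Q? xs

count-∪ : {P Q : X → Set} (P? : Decidable P) (Q? : Decidable Q) →
          (∀ {x} → P x → ¬ Q x) → (xs : List X) →
          count (P? ∪? Q?) xs ≡ count P? xs + count Q? xs
count-∪ P? Q? disjoint [] = refl
count-∪ P? Q? disjoint (x ∷ xs) with P? x | Q? x
... | yes p | yes q = ⊥-elim (disjoint p q)
... | yes _ | no _  = cong suc (count-∪ P? Q? disjoint xs)
... | no _  | yes _ = trans (cong suc (count-∪ P? Q? disjoint xs)) (sym (ℕₚ.+-suc _ _))
... | no _  | no _  = count-∪ P? Q? disjoint xs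

kronecker : ℤ → ℤ → ℕ
kronecker c s = if does (c ℤ.≟ s) then 1 else 0

count-singleton : (f : X → ℤ) (x : X) {c : ℤ} (s : ℤ) → f x ≡ c →
                  count (λ y → f y ℤ.≟ s) (x ∷ []) ≡ kronecker c s
count-singleton f x s refl with does (f x ℤ.≟ s)
... | true  = refl
... | false = refl

abs-suc-split : ∀ {k} z → ∣ z ∣ ≡ suc k → z ≡ + suc k ⊎ z ≡ -[1+ k ]
abs-suc-split (+ _)      eq = inj₁ (cong +_ eq)
abs-suc-split -[1+ _ ] eq = inj₂ (cong -[1+_] (ℕₚ.suc-injective eq))

abs-suc-join : ∀ {k z} → z ≡ + suc k ⊎ z ≡ -[1+ k ] → ∣ z ∣ ≡ suc k
abs-suc-join (inj₁ refl) = refl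
abs-suc-join (inj₂ refl) = refl

count-abs-zero : (f : X → ℤ) (xs : List X) →
                 count (λ x → ∣ f x ∣ ℕ.≟ 0) xs ≡ count (λ x → f x ℤ.≟ 0ℤ) xs
count-abs-zero f = count-≐ _ _ (ℤₚ.∣i∣≡0⇒i≡0 , cong ∣_∣)

count-abs-suc : (f : X → ℤ) (xs : List X) (k : ℕ) →
                count (λ x → ∣ f x ∣ ℕ.≟ suc k) xs
                ≡ count (λ x → f x ℤ.≟ + suc k) xs + count (λ x → f x ℤ.≟ -[1+ k ]) xs
count-abs-suc f xs k =
  trans (count-≐ _ (positive ∪? negative) (abs-suc-split (f _) , abs-suc-join) xs)
        (count-∪ positive negative (λ p q → +≢- (trans (sym p) q)) xs)
  where
  positive = λ x → f x ℤ.≟ + suc k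
  negative = λ x → f x ℤ.≟ -[1+ k ]
  +≢- : ¬ (+ suc k ≡ -[1+ k ])
  +≢- ()

abs-transfer : (f : X → ℤ) (g : Y → ℤ) (xs : List X) (ys : List Y) →
  (∀ s → count (λ x → f x ℤ.≟ s) xs ≡ count (λ y → g y ℤ.≟ s) ys) →
  ∀ k → count (λ x → ∣ f x ∣ ℕ.≟ k) xs ≡ count (λ y → ∣ g y ∣ ℕ.≟ k) ys
abs-transfer f g xs ys same zero =
  trans (count-abs-zero f xs) (trans (same 0ℤ) (sym (count-abs-zero g ys)))
abs-transfer f g xs ys same (suc k) =
  trans (count-abs-suc f xs k)
        (trans (cong₂ _+_ (same (+ suc k)) (same -[1+ k ])) (sym (count-abs-suc g ys k)))

choose : ℕ → ℤ → ℕ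
choose n (+ k)      = n C k
choose n -[1+ k ] = 0

choose-pascal : ∀ n i → choose (suc n) i ≡ choose n (i - 1ℤ) + choose n i
choose-pascal n (+ zero)    = refl
choose-pascal n (+ suc k)   = sym (nCk+nC[k+1]≡[n+1]C[k+1] n k)
choose-pascal n -[1+ k ] = refl

choose-above : ∀ n k → choose n (+ (n + suc k)) ≡ 0
choose-above n k = k>n⇒nCk≡0 (ℕₚ.m<m+n n (ℕ.s≤s ℕ.z≤n))

Φ : ℕ → ℕ → ℕ → ℕ → ℤ → ℕ
Φ a b μ ν s = choose a (+ μ - s) * choose b (+ ν ℤ.+ s)

Φ-transfer : ∀ a b μ ν s → Φ a b μ (suc ν) s ≡ Φ a b (suc μ) ν (s ℤ.+ 1ℤ)
Φ-transfer a b μ ν s =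
  cong₂ (λ i j → choose a i * choose b j) (lower (+ μ) s) (upper (+ ν) s)
  where
  lower : ∀ μ s → μ - s ≡ (1ℤ ℤ.+ μ) - (s ℤ.+ 1ℤ)
  lower = solve-∀
  upper : ∀ ν s → (1ℤ ℤ.+ ν) ℤ.+ s ≡ ν ℤ.+ (s ℤ.+ 1ℤ)
  upper = solve-∀

Φ-transfer⁻ : ∀ a b μ ν s → Φ a b (suc μ) ν s ≡ Φ a b μ (suc ν) (s - 1ℤ)
Φ-transfer⁻ a b μ ν s =
  cong₂ (λ i j → choose a i * choose b j) (lower (+ μ) s) (upper (+ ν) s)
  where
  lower : ∀ μ s → (1ℤ ℤ.+ μ) - s ≡ μ - (s - 1ℤ)
  lower = solve-∀
  upper : ∀ ν s → ν ℤ.+ s ≡ (1ℤ ℤ.+ ν) ℤ.+ (s - 1ℤ)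
  upper = solve-∀

Φ-pascalˡ : ∀ a b μ ν s → Φ (suc a) b (suc μ) ν s ≡ Φ a b μ ν s + Φ a b (suc μ) ν s
Φ-pascalˡ a b μ ν s = begin
  choose (suc a) (+ suc μ - s) * B
    ≡⟨ cong (_* B) (choose-pascal a (+ suc μ - s)) ⟩
  (choose a (+ suc μ - s - 1ℤ) + choose a (+ suc μ - s)) * B
    ≡⟨ ℕₚ.*-distribʳ-+ B (choose a (+ suc μ - s - 1ℤ)) _ ⟩
  choose a (+ suc μ - s - 1ℤ) * B + choose a (+ suc μ - s) * B
    ≡⟨ cong (λ i → choose a i * B + Φ a b (suc μ) ν s) (lower (+ μ) s) ⟩
  Φ a b μ ν s + Φ a b (suc μ) ν s ∎
  where
  B = choose b (+ ν ℤ.+ s)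
  lower : ∀ μ s → (1ℤ ℤ.+ μ) - s - 1ℤ ≡ μ - s
  lower = solve-∀

Φ-pascalʳ : ∀ a b μ ν s → Φ a (suc b) μ (suc ν) s ≡ Φ a b μ ν s + Φ a b μ (suc ν) s
Φ-pascalʳ a b μ ν s = begin
  A * choose (suc b) (+ suc ν ℤ.+ s)
    ≡⟨ cong (A *_) (choose-pascal b (+ suc ν ℤ.+ s)) ⟩
  A * (choose b (+ suc ν ℤ.+ s - 1ℤ) + choose b (+ suc ν ℤ.+ s))
    ≡⟨ ℕₚ.*-distribˡ-+ A (choose b (+ suc ν ℤ.+ s - 1ℤ)) _ ⟩
  A * choose b (+ suc ν ℤ.+ s - 1ℤ) + A * choose b (+ suc ν ℤ.+ s)
    ≡⟨ cong (λ j → A * choose b j + Φ a b μ (suc ν) s) (upper (+ ν) s) ⟩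
  Φ a b μ ν s + Φ a b μ (suc ν) s ∎
  where
  A = choose a (+ μ - s)
  upper : ∀ ν s → (1ℤ ℤ.+ ν) ℤ.+ s - 1ℤ ≡ ν ℤ.+ s
  upper = solve-∀

Φ-pascalˡ′ : ∀ a b μ ν s → Φ (suc a) b μ (suc ν) s ≡ Φ a b μ ν (s ℤ.+ 1ℤ) + Φ a b μ (suc ν) s
Φ-pascalˡ′ a b μ ν s = begin
  Φ (suc a) b μ (suc ν) s
    ≡⟨ Φ-transfer (suc a) b μ ν s ⟩
  Φ (suc a) b (suc μ) ν (s ℤ.+ 1ℤ)
    ≡⟨ Φ-pascalˡ a b μ ν (s ℤ.+ 1ℤ) ⟩
  Φ a b μ ν (s ℤ.+ 1ℤ) + Φ a b (suc μ) ν (s ℤ.+ 1ℤ)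
    ≡⟨ cong (λ t → Φ a b μ ν (s ℤ.+ 1ℤ) + t) (sym (Φ-transfer a b μ ν s)) ⟩
  Φ a b μ ν (s ℤ.+ 1ℤ) + Φ a b μ (suc ν) s ∎

Φ-pascalʳ′ : ∀ a b μ ν s → Φ a (suc b) (suc μ) ν s ≡ Φ a b μ ν (s - 1ℤ) + Φ a b (suc μ) ν s
Φ-pascalʳ′ a b μ ν s = begin
  Φ a (suc b) (suc μ) ν s
    ≡⟨ Φ-transfer⁻ a (suc b) μ ν s ⟩
  Φ a (suc b) μ (suc ν) (s - 1ℤ)
    ≡⟨ Φ-pascalʳ a b μ ν (s - 1ℤ) ⟩
  Φ a b μ ν (s - 1ℤ) + Φ a b μ (suc ν) (s - 1ℤ)
    ≡⟨ cong (λ t → Φ a b μ ν (s - 1ℤ) + t) (sym (Φ-transfer⁻ a b μ ν s)) ⟩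
  Φ a b μ ν (s - 1ℤ) + Φ a b (suc μ) ν s ∎

Φ-lower : ∀ a b s → Φ a b 0 0 s ≡ kronecker 0ℤ s
Φ-lower a b (+ zero)    = refl
Φ-lower a b (+ suc k)   = refl
Φ-lower a b -[1+ k ] = ℕₚ.*-zeroʳ (a C suc k)

Φ-upper : ∀ {a b} μ ν s → a ≡ μ → b ≡ ν → Φ a b μ ν s ≡ kronecker 0ℤ s
Φ-upper μ ν (+ zero) refl refl =
  cong₂ _*_ (diagonal μ) (diagonal ν)
  where
  diagonal : ∀ n → n C (n + 0) ≡ 1
  diagonal n = trans (cong (n C_) (ℕₚ.+-identityʳ n)) (nCn≡1 n)
Φ-upper μ ν (+ suc k) refl refl =
  trans (cong (choose μ (+ μ - + suc k) *_) (choose-above ν k)) (ℕₚ.*-zeroʳ (choose μ (+ μ - + suc k)))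
Φ-upper μ ν -[1+ k ] refl refl =
  cong (_* choose ν (+ ν ℤ.+ -[1+ k ])) (choose-above μ k)

peak-horizontal : ∀ {w} → All Horizontal w → signedPeak w ≡ 0ℤ
peak-horizontal []                             = refl
peak-horizontal (h-left ∷ hs)                  = peak-horizontal hs
peak-horizontal (h-right ∷ [])                 = refl
peak-horizontal (h-right ∷ hs@(h-right ∷ _)) = peak-horizontal hs
peak-horizontal (h-right ∷ hs@(h-left ∷ _))  = peak-horizontal hs

peak-vertical : ∀ {w} → All Vertical w → signedPeak w ≡ 0ℤ
peak-vertical []                         = refl
peak-vertical (v-down ∷ vs)              = peak-vertical vs
peak-vertical (v-up ∷ [])                = refl
peak-vertical (v-up ∷ vs@(v-up ∷ _))   = peak-vertical vs
peak-vertical (v-up ∷ vs@(v-down ∷ _)) = peak-vertical vs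

add-iff : ∀ c t s → c ℤ.+ t ≡ s → t ≡ s - c
add-iff c t s eq = trans (cancel c t) (cong (_- c) eq)
  where
  cancel : ∀ c t → t ≡ c ℤ.+ t - c
  cancel = solve-∀

add-iff⁻ : ∀ c t s → t ≡ s - c → c ℤ.+ t ≡ s
add-iff⁻ c t s eq = trans (cong (λ t → c ℤ.+ t) eq) (cancel c s)
  where
  cancel : ∀ c s → c ℤ.+ (s - c) ≡ s
  cancel = solve-∀

-- the value the rest of a word must take so that the whole word, starting
-- with the letters a b, has signed peak-count s
shift : Arrow → Arrow → ℤ → ℤ
shift up    left s = s - 1ℤ
shift right down s = s ℤ.+ 1ℤ
shift _     _    s = s

peak-cons : ∀ a b s → (λ σ → signedPeak (a ∷ b ∷ σ) ≡ s) ≐ (λ σ → signedPeak (b ∷ σ) ≡ shift a b s)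
peak-cons up left s =
  (λ {σ} eq → add-iff 1ℤ _ s (trans (sym (peak↑← σ)) eq)) ,
  (λ {σ} eq → trans (peak↑← σ) (add-iff⁻ 1ℤ _ s eq))
  where
  increment : ∀ u r → (1ℤ ℤ.+ u) - r ≡ 1ℤ ℤ.+ (u - r)
  increment = solve-∀
  peak↑← : ∀ σ → signedPeak (up ∷ left ∷ σ) ≡ 1ℤ ℤ.+ signedPeak (left ∷ σ)
  peak↑← σ = increment (+ upLeft σ) (+ rightDown σ)
peak-cons right down s =
  (λ {σ} eq → add-iff -1ℤ _ s (trans (sym (peak→↓ σ)) eq)) ,
  (λ {σ} eq → trans (peak→↓ σ) (add-iff⁻ -1ℤ _ s eq))
  where
  decrement : ∀ u r → u - (1ℤ ℤ.+ r) ≡ -1ℤ ℤ.+ (u - r)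
  decrement = solve-∀
  peak→↓ : ∀ σ → signedPeak (right ∷ down ∷ σ) ≡ -1ℤ ℤ.+ signedPeak (down ∷ σ)
  peak→↓ σ = decrement (+ upLeft σ) (+ rightDown σ)
peak-cons up    right s = ≐-refl
peak-cons up    up    s = ≐-refl
peak-cons up    down  s = ≐-refl
peak-cons right right s = ≐-refl
peak-cons right left  s = ≐-refl
peak-cons right up    s = ≐-refl
peak-cons down  _     s = ≐-refl
peak-cons left  _     s = ≐-refl

peaksAfter : Arrow → List Arrow → List Arrow → ℤ → ℕ
peaksAfter p V H s = count (λ σ → signedPeak (p ∷ σ) ℤ.≟ s) (shuffles V H)

count-prefixed : ∀ p x s L →
  count (λ σ → signedPeak (p ∷ σ) ℤ.≟ s) (map (x ∷_) L)
  ≡ count (λ σ → signedPeak (x ∷ σ) ℤ.≟ shift p x s) L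
count-prefixed p x s L = trans (count-map _ (x ∷_) L) (count-≐ _ _ (peak-cons p x s) L)

peaksAfter-step : ∀ p x xs y ys s →
  peaksAfter p (x ∷ xs) (y ∷ ys) s
  ≡ peaksAfter x xs (y ∷ ys) (shift p x s) + peaksAfter y (x ∷ xs) ys (shift p y s)
peaksAfter-step p x xs y ys s =
  trans (count-++ _ (map (x ∷_) (shuffles xs (y ∷ ys))) (map (y ∷_) (shuffles (x ∷ xs) ys)))
        (cong₂ _+_ (count-prefixed p x s (shuffles xs (y ∷ ys))) (count-prefixed p y s (shuffles (x ∷ xs) ys)))

peaksAfter-single : ∀ p x w s → signedPeak (x ∷ w) ≡ 0ℤ →
  count (λ σ → signedPeak (p ∷ σ) ℤ.≟ s) ((x ∷ w) ∷ []) ≡ kronecker 0ℤ (shift p x s)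
peaksAfter-single p x w s noPeak =
  trans (count-prefixed p x s (w ∷ [])) (count-singleton (λ σ → signedPeak (x ∷ σ)) w _ noPeak)

shuffleLaw : List Arrow → List Arrow → ℤ → ℕ
shuffleLaw V H = Φ (occ up V + occ right H) (occ left H + occ down V) (occ up V) (occ down V)

peakLaw : Arrow → List Arrow → List Arrow → ℤ → ℕ
peakLaw up V (left ∷ ys) s =
  Φ (suc (occ up V + occ right ys)) (occ left ys + occ down V) (occ up V) (occ down V) (s - 1ℤ)
peakLaw right (down ∷ xs) H s =
  Φ (suc (occ up xs + occ right H)) (occ left H + occ down xs) (occ up xs) (suc (occ down xs)) s
peakLaw _ V H s = shuffleLaw V H s

peakLaw-no-vertical : ∀ p {y} ys → Horizontal y → ∀ s → peakLaw p [] (y ∷ ys) s ≡ kronecker 0ℤ (shift p y s)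
peakLaw-no-vertical up    ys h-right s = Φ-lower _ _ s
peakLaw-no-vertical up    ys h-left  s = Φ-lower _ _ (s - 1ℤ)
peakLaw-no-vertical right ys h-right s = Φ-lower _ _ s
peakLaw-no-vertical right ys h-left  s = Φ-lower _ _ s
peakLaw-no-vertical down  ys _       s = Φ-lower _ _ s
peakLaw-no-vertical left  ys _       s = Φ-lower _ _ s

peakLaw-no-horizontal : ∀ p {x} xs → Vertical x → ∀ s → peakLaw p (x ∷ xs) [] s ≡ kronecker 0ℤ (shift p x s)
peakLaw-no-horizontal right xs v-down s =
  trans (Φ-transfer _ _ (occ up xs) (occ down xs) s)
        (Φ-upper _ _ (s ℤ.+ 1ℤ) (cong suc (ℕₚ.+-identityʳ (occ up xs))) refl)
peakLaw-no-horizontal right xs v-up s = Φ-upper _ _ s (ℕₚ.+-identityʳ _) refl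
peakLaw-no-horizontal up    xs v-up   s = Φ-upper _ _ s (ℕₚ.+-identityʳ _) refl
peakLaw-no-horizontal up    xs v-down s = Φ-upper _ _ s (ℕₚ.+-identityʳ _) refl
peakLaw-no-horizontal down  xs _      s = Φ-upper _ _ s (ℕₚ.+-identityʳ _) refl
peakLaw-no-horizontal left  xs _      s = Φ-upper _ _ s (ℕₚ.+-identityʳ _) refl

peakLaw-empty : ∀ p s → peakLaw p [] [] s ≡ kronecker 0ℤ s
peakLaw-empty up    s = Φ-lower 0 0 s
peakLaw-empty right s = Φ-lower 0 0 s
peakLaw-empty down  s = Φ-lower 0 0 s
peakLaw-empty left  s = Φ-lower 0 0 s

peak-single : ∀ p → signedPeak (p ∷ []) ≡ 0ℤ
peak-single up    = refl
peak-single right = refl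
peak-single down  = refl
peak-single left  = refl

shuffleLaw-split : ∀ {x y} xs ys → Vertical x → Horizontal y → ∀ s →
  shuffleLaw (x ∷ xs) (y ∷ ys) s ≡ peakLaw x xs (y ∷ ys) s + peakLaw y (x ∷ xs) ys s
shuffleLaw-split xs ys v-up h-right s =
  trans (Φ-pascalˡ (u + suc r) (l + d) u d s)
        (cong (λ a → Φ (u + suc r) (l + d) u d s + Φ a (l + d) (suc u) d s) (ℕₚ.+-suc u r))
  where u = occ up xs ; d = occ down xs ; r = occ right ys ; l = occ left ys
shuffleLaw-split xs ys v-down h-left s =
  trans (Φ-pascalʳ (u + r) (l + suc d) u d s)
        (cong (λ b → Φ (u + r) b u d s + Φ (u + r) (l + suc d) u (suc d) s) (ℕₚ.+-suc l d))
  where u = occ up xs ; d = occ down xs ; r = occ right ys ; l = occ left ys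
shuffleLaw-split xs ys v-up h-left s = Φ-pascalʳ′ (suc u + r) (l + d) u d s
  where u = occ up xs ; d = occ down xs ; r = occ right ys ; l = occ left ys
shuffleLaw-split xs ys v-down h-right s = begin
  Φ (u + suc r) (l + suc d) u (suc d) s
    ≡⟨ cong (λ b → Φ (u + suc r) b u (suc d) s) (ℕₚ.+-suc l d) ⟩
  Φ (u + suc r) (suc (l + d)) u (suc d) s
    ≡⟨ Φ-pascalʳ (u + suc r) (l + d) u d s ⟩
  Φ (u + suc r) (l + d) u d s + Φ (u + suc r) (l + d) u (suc d) s
    ≡⟨ cong (λ a → Φ (u + suc r) (l + d) u d s + Φ a (l + d) u (suc d) s) (ℕₚ.+-suc u r) ⟩
  Φ (u + suc r) (l + d) u d s + Φ (suc (u + r)) (l + d) u (suc d) s ∎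
  where u = occ up xs ; d = occ down xs ; r = occ right ys ; l = occ left ys

peakLaw-step : ∀ p {x y} xs ys → Vertical x → Horizontal y → ∀ s →
  peakLaw p (x ∷ xs) (y ∷ ys) s
  ≡ peakLaw x xs (y ∷ ys) (shift p x s) + peakLaw y (x ∷ xs) ys (shift p y s)
peakLaw-step down  xs ys vx      hy      s = shuffleLaw-split xs ys vx hy s
peakLaw-step left  xs ys vx      hy      s = shuffleLaw-split xs ys vx hy s
peakLaw-step up    xs ys v-up    h-right s = shuffleLaw-split xs ys v-up h-right s
peakLaw-step up    xs ys v-down  h-right s = shuffleLaw-split xs ys v-down h-right s
peakLaw-step right xs ys v-up    h-right s = shuffleLaw-split xs ys v-up h-right s
peakLaw-step right xs ys v-up    h-left  s = shuffleLaw-split xs ys v-up h-left s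
peakLaw-step up    xs ys v-up    h-left  s = Φ-pascalˡ (suc (u + r)) (l + d) u d (s - 1ℤ)
  where u = occ up xs ; d = occ down xs ; r = occ right ys ; l = occ left ys
peakLaw-step up    xs ys v-down  h-left  s = begin
  Φ (suc (u + r)) (l + suc d) u (suc d) (s - 1ℤ)
    ≡⟨ Φ-pascalˡ′ (u + r) (l + suc d) u d (s - 1ℤ) ⟩
  Φ (u + r) (l + suc d) u d (s - 1ℤ ℤ.+ 1ℤ) + Φ (u + r) (l + suc d) u (suc d) (s - 1ℤ)
    ≡⟨ cong (_+ Φ (u + r) (l + suc d) u (suc d) (s - 1ℤ))
            (cong₂ (λ b t → Φ (u + r) b u d t) (ℕₚ.+-suc l d) (cancel s)) ⟩
  Φ (u + r) (suc l + d) u d s + Φ (u + r) (l + suc d) u (suc d) (s - 1ℤ) ∎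
  where
  u = occ up xs ; d = occ down xs ; r = occ right ys ; l = occ left ys
  cancel : ∀ s → s - 1ℤ ℤ.+ 1ℤ ≡ s
  cancel = solve-∀
peakLaw-step right xs ys v-down  h-right s =
  trans (Φ-pascalˡ′ (u + suc r) (l + d) u d s)
        (cong (λ a → Φ (u + suc r) (l + d) u d (s ℤ.+ 1ℤ) + Φ a (l + d) u (suc d) s) (ℕₚ.+-suc u r))
  where u = occ up xs ; d = occ down xs ; r = occ right ys ; l = occ left ys
peakLaw-step right xs ys v-down  h-left  s =
  trans (Φ-pascalˡ′ (u + r) (suc l + d) u d s)
        (cong (λ b → Φ (u + r) (suc l + d) u d (s ℤ.+ 1ℤ) + Φ (u + r) b u (suc d) s) (sym (ℕₚ.+-suc l d)))
  where u = occ up xs ; d = occ down xs ; r = occ right ys ; l = occ left ys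

peaksAfter≡peakLaw : ∀ p {V H} → All Vertical V → All Horizontal H → ∀ s →
                     peaksAfter p V H s ≡ peakLaw p V H s
peaksAfter≡peakLaw p [] [] s =
  trans (count-singleton (λ σ → signedPeak (p ∷ σ)) [] s (peak-single p)) (sym (peakLaw-empty p s))
peaksAfter≡peakLaw p [] hs@(hy ∷ _) s =
  trans (peaksAfter-single p _ _ s (peak-horizontal hs)) (sym (peakLaw-no-vertical p _ hy s))
peaksAfter≡peakLaw p vs@(vx ∷ _) [] s =
  trans (peaksAfter-single p _ _ s (peak-vertical vs)) (sym (peakLaw-no-horizontal p _ vx s))
peaksAfter≡peakLaw p {x ∷ xs} {y ∷ ys} (vx ∷ vs) (hy ∷ hs) s = begin
  peaksAfter p (x ∷ xs) (y ∷ ys) s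
    ≡⟨ peaksAfter-step p x xs y ys s ⟩
  peaksAfter x xs (y ∷ ys) (shift p x s) + peaksAfter y (x ∷ xs) ys (shift p y s)
    ≡⟨ cong₂ _+_ (peaksAfter≡peakLaw x vs (hy ∷ hs) _) (peaksAfter≡peakLaw y (vx ∷ vs) hs _) ⟩
  peakLaw x xs (y ∷ ys) (shift p x s) + peakLaw y (x ∷ xs) ys (shift p y s)
    ≡⟨ sym (peakLaw-step p xs ys vx hy s) ⟩
  peakLaw p (x ∷ xs) (y ∷ ys) s ∎

-- the signed peak-count of shuffles: a letter ↓ in front never changes it
peak-distribution : ∀ {V H} → All Vertical V → All Horizontal H → ∀ s →
                    count (λ σ → signedPeak σ ℤ.≟ s) (shuffles V H) ≡ shuffleLaw V H s
peak-distribution = peaksAfter≡peakLaw down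

ones-split : ∀ w → ones w ≡ onesOdd w + onesEven w
ones-split []          = refl
ones-split (true ∷ w)  = cong suc (trans (ones-split w) (ℕₚ.+-comm (onesOdd w) (onesEven w)))
ones-split (false ∷ w) = trans (ones-split w) (ℕₚ.+-comm (onesOdd w) (onesEven w))

parity-distribution : ∀ L α β →
  count ((λ w → + onesOdd w ℤ.≟ α) ∩? (λ w → + onesEven w ℤ.≟ β)) (allWords L)
  ≡ choose ⌈ L /2⌉ α * choose ⌊ L /2⌋ β
parity-distribution zero (+ zero)  (+ zero)    = refl
parity-distribution zero (+ zero)  (+ suc _)   = refl
parity-distribution zero (+ zero)  -[1+ _ ] = refl
parity-distribution zero (+ suc _) _           = refl
parity-distribution zero -[1+ _ ] _         = refl
parity-distribution (suc L) α β = begin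
  count P? (map (false ∷_) A ++ map (true ∷_) A)
    ≡⟨ count-++ P? (map (false ∷_) A) _ ⟩
  count P? (map (false ∷_) A) + count P? (map (true ∷_) A)
    ≡⟨ cong₂ _+_ (count-map P? (false ∷_) A) (count-map P? (true ∷_) A) ⟩
  count (λ w → P? (false ∷ w)) A + count (λ w → P? (true ∷ w)) A
    ≡⟨ cong₂ _+_ (count-≐ _ (Q? β α) ((λ {w} → swap) , (λ {w} → swap)) A)
                 (count-≐ _ (Q? β (α - 1ℤ)) ((λ {w} → one-more {w}) , (λ {w} → one-less {w})) A) ⟩
  count (Q? β α) A + count (Q? β (α - 1ℤ)) A
    ≡⟨ cong₂ _+_ (parity-distribution L β α) (parity-distribution L β (α - 1ℤ)) ⟩
  c β * e α + c β * e (α - 1ℤ)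
    ≡⟨ ℕₚ.+-comm (c β * e α) _ ⟩
  c β * e (α - 1ℤ) + c β * e α
    ≡⟨ sym (ℕₚ.*-distribˡ-+ (c β) (e (α - 1ℤ)) (e α)) ⟩
  c β * (e (α - 1ℤ) + e α)
    ≡⟨ cong (c β *_) (sym (choose-pascal ⌊ L /2⌋ α)) ⟩
  c β * choose (suc ⌊ L /2⌋) α
    ≡⟨ ℕₚ.*-comm (c β) _ ⟩
  choose ⌈ suc L /2⌉ α * choose ⌊ suc L /2⌋ β ∎
  where
  A = allWords L
  Q? = λ α β → (λ w → + onesOdd w ℤ.≟ α) ∩? (λ w → + onesEven w ℤ.≟ β)
  P? = Q? α β
  c = choose ⌈ L /2⌉
  e = choose ⌊ L /2⌋
  -- a leading one is an extra one at an odd position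
  one-more : ∀ {w} → + suc (onesEven w) ≡ α × + onesOdd w ≡ β → + onesOdd w ≡ β × + onesEven w ≡ α - 1ℤ
  one-more (eq , eq′) = eq′ , add-iff 1ℤ _ α eq
  one-less : ∀ {w} → + onesOdd w ≡ β × + onesEven w ≡ α - 1ℤ → + suc (onesEven w) ≡ α × + onesOdd w ≡ β
  one-less (eq′ , eq) = add-iff⁻ 1ℤ _ α eq , eq′

evenGap : ℕ → List Bool → ℤ
evenGap n w = + onesEven w - + n

balanced-iff : ∀ n s →
  (λ w → ones w ≡ 2 * n × evenGap n w ≡ s) ≐ (λ w → + onesOdd w ≡ + n - s × + onesEven w ≡ + n ℤ.+ s)
balanced-iff n s = (λ {w} → to {w}) , (λ {w} → from {w})
  where
  twice : 2 * n ≡ n + n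
  twice = cong (λ t → n + t) (ℕₚ.+-identityʳ n)
  even-from-gap : ∀ e n → e ≡ n ℤ.+ (e - n)
  even-from-gap = solve-∀
  odd-from-sum : ∀ o e → o ≡ (o ℤ.+ e) - e
  odd-from-sum = solve-∀
  odd-value : ∀ n s → (n ℤ.+ n) - (n ℤ.+ s) ≡ n - s
  odd-value = solve-∀
  sum-value : ∀ n s → (n - s) ℤ.+ (n ℤ.+ s) ≡ n ℤ.+ n
  sum-value = solve-∀
  gap-value : ∀ n s → (n ℤ.+ s) - n ≡ s
  gap-value = solve-∀
  to : ∀ {w} → ones w ≡ 2 * n × evenGap n w ≡ s → + onesOdd w ≡ + n - s × + onesEven w ≡ + n ℤ.+ s
  to {w} (total , gap) = odd , even
    where
    even : + onesEven w ≡ + n ℤ.+ s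
    even = trans (even-from-gap (+ onesEven w) (+ n)) (cong (λ t → + n ℤ.+ t) gap)
    sum : + onesOdd w ℤ.+ + onesEven w ≡ + n ℤ.+ + n
    sum = cong +_ (trans (sym (ones-split w)) (trans total twice))
    odd : + onesOdd w ≡ + n - s
    odd = trans (odd-from-sum (+ onesOdd w) (+ onesEven w))
                (trans (cong₂ _-_ sum even) (odd-value (+ n) s))
  from : ∀ {w} → + onesOdd w ≡ + n - s × + onesEven w ≡ + n ℤ.+ s → ones w ≡ 2 * n × evenGap n w ≡ s
  from {w} (odd , even) = total , gap
    where
    total : ones w ≡ 2 * n
    total = trans (ones-split w)
                  (trans (ℤₚ.+-injective (trans (cong₂ ℤ._+_ odd even) (sum-value (+ n) s))) (sym twice))
    gap : evenGap n w ≡ s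
    gap = trans (cong (_- + n) even) (gap-value (+ n) s)

evenGap-distribution : ∀ m n s → count (λ w → evenGap n w ℤ.≟ s) (W m n) ≡ Φ (m + n) (m + n) n n s
evenGap-distribution m n s = begin
  count (λ w → evenGap n w ℤ.≟ s) (filter (λ w → ones w ℕ.≟ 2 * n) (allWords L))
    ≡⟨ count-filter _ _ (allWords L) ⟩
  count ((λ w → ones w ℕ.≟ 2 * n) ∩? (λ w → evenGap n w ℤ.≟ s)) (allWords L)
    ≡⟨ count-≐ _ _ (balanced-iff n s) (allWords L) ⟩
  count ((λ w → + onesOdd w ℤ.≟ + n - s) ∩? (λ w → + onesEven w ℤ.≟ + n ℤ.+ s)) (allWords L)
    ≡⟨ parity-distribution L (+ n - s) (+ n ℤ.+ s) ⟩
  choose ⌈ L /2⌉ (+ n - s) * choose ⌊ L /2⌋ (+ n ℤ.+ s)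
    ≡⟨ cong₂ (λ a b → Φ a b n n s) (trans (cong ⌈_/2⌉ halves) (sym (ℕₚ.n≡⌈n+n/2⌉ (m + n))))
                                    (trans (cong ⌊_/2⌋ halves) (sym (ℕₚ.n≡⌊n+n/2⌋ (m + n)))) ⟩
  Φ (m + n) (m + n) n n s ∎
  where
  L = 2 * m + 2 * n
  halves : L ≡ (m + n) + (m + n)
  halves = double m n
    where
    double : ∀ m n → 2 * m + 2 * n ≡ (m + n) + (m + n)
    double = ℕ-Solver.solve-∀

absEvenCount-evenGap : ∀ n w → ones w ≡ 2 * n → absEvenCount w ≡ ∣ evenGap n w ∣
absEvenCount-evenGap n w total = begin
  ∣ + (2 * onesEven w) - + ones w ∣ / 2
    ≡⟨ cong (λ t → ∣ + (2 * onesEven w) - + t ∣ / 2) total ⟩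
  ∣ + (2 * onesEven w) - + (2 * n) ∣ / 2
    ≡⟨ cong (λ z → ∣ z ∣ / 2) (double (onesEven w) n) ⟩
  ∣ + 2 ℤ.* evenGap n w ∣ / 2
    ≡⟨ cong (_/ 2) (trans (ℤₚ.abs-* (+ 2) (evenGap n w)) (ℕₚ.*-comm 2 ∣ evenGap n w ∣)) ⟩
  ∣ evenGap n w ∣ * 2 / 2
    ≡⟨ m*n/n≡m ∣ evenGap n w ∣ 2 ⟩
  ∣ evenGap n w ∣ ∎
  where
  factor : ∀ e n → + 2 ℤ.* e - + 2 ℤ.* n ≡ + 2 ℤ.* (e - n)
  factor = solve-∀
  double : ∀ e n → + (2 * e) - + (2 * n) ≡ + 2 ℤ.* (+ e - + n)
  double e n = trans (cong₂ _-_ (ℤₚ.pos-* 2 e) (ℤₚ.pos-* 2 n)) (factor (+ e) (+ n))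

countAbsEven-evenGap : ∀ m n k → countAbsEven k (W m n) ≡ count (λ w → ∣ evenGap n w ∣ ℕ.≟ k) (W m n)
countAbsEven-evenGap m n k = begin
  count (λ w → absEvenCount w ℕ.≟ k) (filter Q? A)
    ≡⟨ count-filter _ Q? A ⟩
  count (Q? ∩? (λ w → absEvenCount w ℕ.≟ k)) A
    ≡⟨ count-≐ _ _ ((λ {w} → same w) , (λ {w} → same⁻ w)) A ⟩
  count (Q? ∩? (λ w → ∣ evenGap n w ∣ ℕ.≟ k)) A
    ≡⟨ sym (count-filter _ Q? A) ⟩
  count (λ w → ∣ evenGap n w ∣ ℕ.≟ k) (filter Q? A) ∎
  where
  A = allWords (2 * m + 2 * n)
  Q? = λ w → ones w ℕ.≟ 2 * n
  same : ∀ w → ones w ≡ 2 * n × absEvenCount w ≡ k → ones w ≡ 2 * n × ∣ evenGap n w ∣ ≡ k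
  same w (total , eq) = total , trans (sym (absEvenCount-evenGap n w total)) eq
  same⁻ : ∀ w → ones w ≡ 2 * n × ∣ evenGap n w ∣ ≡ k → ones w ≡ 2 * n × absEvenCount w ≡ k
  same⁻ w (total , eq) = total , trans (absEvenCount-evenGap n w total) eq

signed-equidistribution : ∀ m n {H V} → All Horizontal H → occ right H ≡ m → occ left H ≡ m →
  All Vertical V → occ up V ≡ n → occ down V ≡ n →
  ∀ s → count (λ σ → signedPeak σ ℤ.≟ s) (shuffles V H) ≡ count (λ w → evenGap n w ℤ.≟ s) (W m n)
signed-equidistribution m n {H} {V} ah hr hl av vu vd s = begin
  count (λ σ → signedPeak σ ℤ.≟ s) (shuffles V H)
    ≡⟨ peak-distribution av ah s ⟩
  shuffleLaw V H s
    ≡⟨ letter-counts ⟩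
  Φ (n + m) (m + n) n n s
    ≡⟨ cong (λ a → Φ a (m + n) n n s) (ℕₚ.+-comm n m) ⟩
  Φ (m + n) (m + n) n n s
    ≡⟨ sym (evenGap-distribution m n s) ⟩
  count (λ w → evenGap n w ℤ.≟ s) (W m n) ∎
  where
  letter-counts : shuffleLaw V H s ≡ Φ (n + m) (m + n) n n s
  letter-counts rewrite hr | hl | vu | vd = refl

abs-equidistribution : ∀ m n {H V} → All Horizontal H → occ right H ≡ m → occ left H ≡ m →
  All Vertical V → occ up V ≡ n → occ down V ≡ n →
  ∀ k → countAbsPeak k (shuffles V H) ≡ countAbsEven k (W m n)
abs-equidistribution m n {H} {V} ah hr hl av vu vd k =
  trans (abs-transfer signedPeak (evenGap n) (shuffles V H) (W m n)
           (signed-equidistribution m n ah hr hl av vu vd) k)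
        (sym (countAbsEven-evenGap m n k))

ups-stairs : ∀ a b → occ up (replicate a up ++ replicate b down) ≡ a
ups-stairs (suc a) b    = cong suc (ups-stairs a b)
ups-stairs zero zero    = refl
ups-stairs zero (suc b) = ups-stairs zero b

downs-stairs : ∀ a b → occ down (replicate a up ++ replicate b down) ≡ b
downs-stairs (suc a) b    = downs-stairs a b
downs-stairs zero zero    = refl
downs-stairs zero (suc b) = cong suc (downs-stairs zero b)

rights-stairs : ∀ a b → occ right (replicate a right ++ replicate b left) ≡ a
rights-stairs (suc a) b    = cong suc (rights-stairs a b)
rights-stairs zero zero    = refl
rights-stairs zero (suc b) = rights-stairs zero b

lefts-stairs : ∀ a b → occ left (replicate a right ++ replicate b left) ≡ b
lefts-stairs (suc a) b    = lefts-stairs a b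
lefts-stairs zero zero    = refl
lefts-stairs zero (suc b) = cong suc (lefts-stairs zero b)

lemma3p9 : (m n : ℕ) (H V : List Arrow) →
    All Horizontal H → occ right H ≡ m → occ left H ≡ m →
    All Vertical V → occ up V ≡ n → occ down V ≡ n →
    ((k : ℕ) → countAbsPeak k (shuffles V H) ≡ countAbsEven k (W m n))
    × ((k : ℕ) → F-coeff m m n n k ≡ countAbsEven k (W m n))
lemma3p9 m n H V ah hr hl av vu vd =
  abs-equidistribution m n ah hr hl av vu vd ,
  abs-equidistribution m n
    (++⁺ (replicate⁺ m h-right) (replicate⁺ m h-left)) (rights-stairs m m) (lefts-stairs m m)
    (++⁺ (replicate⁺ n v-up) (replicate⁺ n v-down)) (ups-stairs n n) (downs-stairs n n)
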